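{- In $\mathbf{IPF}^I$, for every formula $F$ and distinct variables $x,y$ ($y$ not occurring in $F$): $\exists y\, Ix[F,x=y]\vdash Ix[F,\exists!x]$.
   Context: $\mathbf{IPF}$ is a natural deduction system of intuitionist positive free logic: a first-order language without function symbols, terms constants and parameters, primitive predicate $\exists!$ ("exists"), identity; standard intuitionist rules for $\land,\rightarrow,\lor,\leftrightarrow$, $\bot E$ to atomic conclusions; $\forall I$ (infer $\forall xA$ from a deduction of $A^x_a$, discharging $\exists!a$, $a$ fresh), $\forall E$ (from $\forall xA$, $\exists!t$ infer $A^x_t$), $\exists I$ (from $A^x_t$, $\exists!t$ infer $\exists xA$), $\exists E$ (from $\exists xA$ and a deduction of $C$ from $A^x_a,\exists!a$ infer $C$, discharging them, $a$ fresh); $=I$: axiom $t=t$; $=E$: from $t_1=t_2$ and $A^x_{t_1}$ infer $A^x_{t_2}$ ($A$ atomic). $\mathbf{IPF}^I$ adds formulas $Ix[F,G]$ ("the $F$ is $G$", binding $x$) with rules ($a,b$ fresh parameters not occurring in $F,G,C$ or other open assumptions of the subdeduction, $a\neq t$): $II$: from $F^x_t,G^x_t,\exists!t$ and a deduction of $a=t$ from $F^x_a,\exists!a$ (discharged) infer $Ix[F,G]$; $IE^{1p}$: from $Ix[F,G]$, $F^x_t$, $\exists!t$, a deduction of $a=t$ from $F^x_a,\exists!a$ and a deduction of $C$ from $F^x_b,G^x_b,\exists!b$ (all discharged) infer $C$; $IE^{2p}$: from $Ix[F,\exists!x],\exists!t_1,\exists!t_2,F^x_{t_1},F^x_{t_2},A^x_{t_1}$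 infer $A^x_{t_2}$ ($A$ atomic); $IE^{3p}$: from $Ix[F,\exists!x]$ and a deduction of $C$ from $F^x_a,\exists!a$ (discharged) infer $C$; $IE^{4p}$: from $Ix[F,x=t_2],\exists!t_1,\exists!t_2,F^x_{t_1},A^x_{t_1}$ infer $A^x_{t_2}$ ($A$ atomic); $IE^{5p}$: from $Ix[F,x=t],\exists!t$ and a deduction of $C$ from $F^x_a,\exists!a$ (discharged) infer $C$. -}

module Defs where

open import Data.Nat using (ℕ; _≟_)
open import Data.List using (List; []; _∷_; _++_; [_]; map; concatMap)
open import Data.List.Membership.Propositional using (_∈_; _∉_)
open import Data.List.Relation.Unary.All using (All)
open import Relation.Nullary using (¬_; yes; no)
open import Relation.Binary.PropositionalEquality using (_≡_; _≢_)

data CTerm : Set where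
  con : ℕ → CTerm
  par : ℕ → CTerm

-- Terms occurring inside formulas: (bound) variables, constants, parameters.
data Term : Set where
  var : ℕ → Term
  con : ℕ → Term
  par : ℕ → Term

⌜_⌝ : CTerm → Term
⌜ con c ⌝ = con c
⌜ par a ⌝ = par a

infixr 6 _∧'_
infixr 5 _∨'_
infixr 4 _⇒_ _⇔_
infix 7 _≐_

data Formula : Set where
  atom : ℕ → List Term → Formula
  E!   : Term → Formula
  _≐_  : Term → Term → Formula
  ⊥'   : Formula
  _∧'_ _∨'_ _⇒_ _⇔_ : Formula → Formula → Formula
  ∀' ∃' : ℕ → Formula → Formula
  I    : ℕ → Formula → Formula → Formula

data Atomic : Formula → Set where
  atom : ∀ P ts → Atomic (atom P ts)
  E!   : ∀ t → Atomic (E! t)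
  eq   : ∀ t u → Atomic (t ≐ u)

-- Substitution A^x_t of a closed term t for the free occurrences of x
-- (capture is impossible since t is closed)

substT : ℕ → CTerm → Term → Term
substT x t (var y) with x ≟ y
... | yes _ = ⌜ t ⌝
... | no  _ = var y
substT x t (con c) = con c
substT x t (par a) = par a

_[_≔_] : Formula → ℕ → CTerm → Formula
atom P ts [ x ≔ t ] = atom P (map (substT x t) ts)
E! s      [ x ≔ t ] = E! (substT x t s)
(s ≐ u)   [ x ≔ t ] = substT x t s ≐ substT x t u
⊥'        [ x ≔ t ] = ⊥'
(A ∧' B)  [ x ≔ t ] = (A [ x ≔ t ]) ∧' (B [ x ≔ t ])
(A ∨' B)  [ x ≔ t ] = (A [ x ≔ t ]) ∨' (B [ x ≔ t ])
(A ⇒ B)   [ x ≔ t ] = (A [ x ≔ t ]) ⇒ (B [ x ≔ t ])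
(A ⇔ B)   [ x ≔ t ] = (A [ x ≔ t ]) ⇔ (B [ x ≔ t ])
∀' y A    [ x ≔ t ] with x ≟ y
... | yes _ = ∀' y A
... | no  _ = ∀' y (A [ x ≔ t ])
∃' y A    [ x ≔ t ] with x ≟ y
... | yes _ = ∃' y A
... | no  _ = ∃' y (A [ x ≔ t ])
I y F G   [ x ≔ t ] with x ≟ y
... | yes _ = I y F G
... | no  _ = I y (F [ x ≔ t ]) (G [ x ≔ t ])

paramsT : Term → List ℕ
paramsT (par a) = [ a ]
paramsT _       = []

params : Formula → List ℕ
params (atom P ts) = concatMap paramsT ts
params (E! t)      = paramsT t
params (t ≐ u)     = paramsT t ++ paramsT u
params ⊥'          = []
params (A ∧' B)    = params A ++ params B
params (A ∨' B)    = params A ++ params B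
params (A ⇒ B)     = params A ++ params B
params (A ⇔ B)     = params A ++ params B
params (∀' x A)    = params A
params (∃' x A)    = params A
params (I x F G)   = params F ++ params G

_#_ : ℕ → Formula → Set
a # A = a ∉ params A

_#ᶜ_ : ℕ → List Formula → Set
a #ᶜ Γ = All (a #_) Γ

varsT : Term → List ℕ
varsT (var y) = [ y ]
varsT _       = []

vars : Formula → List ℕ
vars (atom P ts) = concatMap varsT ts
vars (E! t)      = varsT t
vars (t ≐ u)     = varsT t ++ varsT u
vars ⊥'          = []
vars (A ∧' B)    = vars A ++ vars B
vars (A ∨' B)    = vars A ++ vars B
vars (A ⇒ B)     = vars A ++ vars B
vars (A ⇔ B)     = vars A ++ vars B
vars (∀' x A)    = x ∷ vars A
vars (∃' x A)    = x ∷ vars A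
vars (I x F G)   = x ∷ vars F ++ vars G

-- Natural deduction for IPF^I, in sequent style:
-- Γ ⊢ A  means: there is a deduction of A whose open assumptions are in Γ.
-- Discharged assumptions are added to the context of the subdeduction.

infix 2 _⊢_

p : ℕ → Term
p a = par a

data _⊢_ (Γ : List Formula) : Formula → Set where
  hyp  : ∀ {A} → A ∈ Γ → Γ ⊢ A
  ∧I   : ∀ {A B} → Γ ⊢ A → Γ ⊢ B → Γ ⊢ A ∧' B
  ∧E₁  : ∀ {A B} → Γ ⊢ A ∧' B → Γ ⊢ A
  ∧E₂  : ∀ {A B} → Γ ⊢ A ∧' B → Γ ⊢ B
  ⇒I   : ∀ {A B} → (A ∷ Γ) ⊢ B → Γ ⊢ A ⇒ B
  ⇒E   : ∀ {A B} → Γ ⊢ A ⇒ B → Γ ⊢ A → Γ ⊢ B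
  ∨I₁  : ∀ {A B} → Γ ⊢ A → Γ ⊢ A ∨' B
  ∨I₂  : ∀ {A B} → Γ ⊢ B → Γ ⊢ A ∨' B
  ∨E   : ∀ {A B C} → Γ ⊢ A ∨' B → (A ∷ Γ) ⊢ C → (B ∷ Γ) ⊢ C → Γ ⊢ C
  ⇔I   : ∀ {A B} → (A ∷ Γ) ⊢ B → (B ∷ Γ) ⊢ A → Γ ⊢ A ⇔ B
  ⇔E₁  : ∀ {A B} → Γ ⊢ A ⇔ B → Γ ⊢ A → Γ ⊢ B
  ⇔E₂  : ∀ {A B} → Γ ⊢ A ⇔ B → Γ ⊢ B → Γ ⊢ A
  ⊥E   : ∀ {A} → Atomic A → Γ ⊢ ⊥' → Γ ⊢ A
  ∀I   : ∀ {x A} (a : ℕ) → a #ᶜ Γ → a # ∀' x A →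
         (E! (p a) ∷ Γ) ⊢ A [ x ≔ par a ] → Γ ⊢ ∀' x A
  ∀E   : ∀ {x A} (t : CTerm) → Γ ⊢ ∀' x A → Γ ⊢ E! ⌜ t ⌝ → Γ ⊢ A [ x ≔ t ]
  ∃I   : ∀ {x A} (t : CTerm) → Γ ⊢ A [ x ≔ t ] → Γ ⊢ E! ⌜ t ⌝ → Γ ⊢ ∃' x A
  ∃E   : ∀ {x A C} (a : ℕ) → a #ᶜ Γ → a # ∃' x A → a # C →
         Γ ⊢ ∃' x A → (A [ x ≔ par a ] ∷ E! (p a) ∷ Γ) ⊢ C → Γ ⊢ C
  =I   : (t : CTerm) → Γ ⊢ ⌜ t ⌝ ≐ ⌜ t ⌝
  =E   : ∀ {x A} (t₁ t₂ : CTerm) → Atomic A →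
         Γ ⊢ ⌜ t₁ ⌝ ≐ ⌜ t₂ ⌝ → Γ ⊢ A [ x ≔ t₁ ] → Γ ⊢ A [ x ≔ t₂ ]
  II   : ∀ {x F G} (t : CTerm) (a : ℕ) →
         a #ᶜ Γ → a # F → a # G → par a ≢ t →
         Γ ⊢ F [ x ≔ t ] → Γ ⊢ G [ x ≔ t ] → Γ ⊢ E! ⌜ t ⌝ →
         (F [ x ≔ par a ] ∷ E! (p a) ∷ Γ) ⊢ p a ≐ ⌜ t ⌝ →
         Γ ⊢ I x F G
  IE¹ᵖ : ∀ {x F G C} (t : CTerm) (a b : ℕ) →
         a #ᶜ Γ → a # F → a # G → a # C → par a ≢ t →
         b #ᶜ Γ → b # F → b # G → b # C →
         Γ ⊢ I x F G → Γ ⊢ F [ x ≔ t ] → Γ ⊢ E! ⌜ t ⌝ →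
         (F [ x ≔ par a ] ∷ E! (p a) ∷ Γ) ⊢ p a ≐ ⌜ t ⌝ →
         (F [ x ≔ par b ] ∷ G [ x ≔ par b ] ∷ E! (p b) ∷ Γ) ⊢ C →
         Γ ⊢ C
  IE²ᵖ : ∀ {x F A} (t₁ t₂ : CTerm) → Atomic A →
         Γ ⊢ I x F (E! (var x)) → Γ ⊢ E! ⌜ t₁ ⌝ → Γ ⊢ E! ⌜ t₂ ⌝ →
         Γ ⊢ F [ x ≔ t₁ ] → Γ ⊢ F [ x ≔ t₂ ] → Γ ⊢ A [ x ≔ t₁ ] →
         Γ ⊢ A [ x ≔ t₂ ]
  IE³ᵖ : ∀ {x F C} (a : ℕ) → a #ᶜ Γ → a # F → a # C →
         Γ ⊢ I x F (E! (var x)) →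
         (F [ x ≔ par a ] ∷ E! (p a) ∷ Γ) ⊢ C → Γ ⊢ C
  IE⁴ᵖ : ∀ {x F A} (t₁ t₂ : CTerm) → Atomic A →
         Γ ⊢ I x F (var x ≐ ⌜ t₂ ⌝) → Γ ⊢ E! ⌜ t₁ ⌝ → Γ ⊢ E! ⌜ t₂ ⌝ →
         Γ ⊢ F [ x ≔ t₁ ] → Γ ⊢ A [ x ≔ t₁ ] → Γ ⊢ A [ x ≔ t₂ ]
  IE⁵ᵖ : ∀ {x F C} (t : CTerm) (a : ℕ) → a #ᶜ Γ → a # F → a # C →
         par a ≢ t →
         Γ ⊢ I x F (var x ≐ ⌜ t ⌝) → Γ ⊢ E! ⌜ t ⌝ →
         (F [ x ≔ par a ] ∷ E! (p a) ∷ Γ) ⊢ C → Γ ⊢ C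

{-# OPTIONS --safe #-}
module Submission where

-- From ∃y Ix[F, x = y] take a fresh a with Ix[F, x = a] and ∃!a. By IE⁵ᵖ some b has F(b)
-- and ∃!b, and this b witnesses Ix[F, ∃!x] by II: by IE⁴ᵖ every existing c with F(c)
-- satisfies c = a, and so does b, hence c = b.

open import Defs
open import Data.Nat using (ℕ; suc; _+_; _<_; _≟_)
open import Data.Nat.Properties using (<⇒≱; m≤n+m; 1+n≢n; m+1+n≢n)
open import Data.List using (List; []; _∷_; [_]; _++_; map; concatMap)
open import Data.List.Extrema.Nat using (max; xs≤max)
open import Data.List.Membership.Propositional using (_∈_; _∉_)
open import Data.List.Membership.Propositional.Properties using (∈-++⁻; ∈-++⁺ˡ; ∈-++⁺ʳ)
open import Data.List.Relation.Unary.Any using (here; there)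
open import Data.List.Relation.Unary.All using (_∷_; [])
import Data.List.Relation.Unary.All as All
open import Data.Sum using (inj₁; inj₂)
open import Function using (_∘_)
open import Relation.Nullary using (yes; no)
open import Relation.Binary.PropositionalEquality
  using (_≡_; _≢_; refl; sym; trans; cong; cong₂; subst)

private
  variable
    k y : ℕ
    xs ys : List ℕ
    Γ : List Formula

∉-++⁺ : k ∉ xs → k ∉ ys → k ∉ xs ++ ys
∉-++⁺ {xs = xs} k∉xs k∉ys k∈ with ∈-++⁻ xs k∈
... | inj₁ k∈xs = k∉xs k∈xs
... | inj₂ k∈ys = k∉ys k∈ys

∉-++⁻ˡ : k ∉ xs ++ ys → k ∉ xs
∉-++⁻ˡ k∉ k∈xs = k∉ (∈-++⁺ˡ k∈xs)

∉-++⁻ʳ : ∀ xs → k ∉ xs ++ ys → k ∉ ys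
∉-++⁻ʳ xs k∉ k∈ys = k∉ (∈-++⁺ʳ xs k∈ys)

∉-∷⁻ : ∀ {m} → k ∉ m ∷ xs → k ∉ xs
∉-∷⁻ k∉ k∈xs = k∉ (there k∈xs)

∉-[_] : ∀ {m} → k ≢ m → k ∉ [ m ]
∉-[ k≢m ] (here k≡m) = k≢m k≡m

>max⇒∉ : max 0 xs < k → k ∉ xs
>max⇒∉ {xs = xs} max<k k∈xs = <⇒≱ max<k (All.lookup (xs≤max 0 xs) k∈xs)

par-≢ : ∀ {m n} → m ≢ n → _≢_ {A = CTerm} (par m) (par n)
par-≢ m≢n refl = m≢n refl

substT-self : ∀ x t → substT x t (var x) ≡ ⌜ t ⌝
substT-self x t with x ≟ x
... | yes _ = refl
... | no x≢x with () ← x≢x refl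

substT-closed : ∀ x t u → substT x t ⌜ u ⌝ ≡ ⌜ u ⌝
substT-closed x t (con c) = refl
substT-closed x t (par a) = refl

substT-fresh : ∀ t u → y ∉ varsT u → substT y t u ≡ u
substT-fresh {y} t (var z) y∉ with y ≟ z
... | yes y≡z with () ← y∉ (here y≡z)
... | no _ = refl
substT-fresh t (con c) _ = refl
substT-fresh t (par a) _ = refl

map-substT-fresh : ∀ t us → y ∉ concatMap varsT us → map (substT y t) us ≡ us
map-substT-fresh t [] _ = refl
map-substT-fresh t (u ∷ us) y∉ =
  cong₂ _∷_ (substT-fresh t u (∉-++⁻ˡ y∉)) (map-substT-fresh t us (∉-++⁻ʳ (varsT u) y∉))

[≔]-fresh : ∀ t A → y ∉ vars A → A [ y ≔ t ] ≡ A
[≔]-fresh t (atom P us) y∉ = cong (atom P) (map-substT-fresh t us y∉)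
[≔]-fresh t (E! u) y∉ = cong E! (substT-fresh t u y∉)
[≔]-fresh t (u ≐ v) y∉ =
  cong₂ _≐_ (substT-fresh t u (∉-++⁻ˡ y∉)) (substT-fresh t v (∉-++⁻ʳ (varsT u) y∉))
[≔]-fresh t ⊥' _ = refl
[≔]-fresh t (A ∧' B) y∉ =
  cong₂ _∧'_ ([≔]-fresh t A (∉-++⁻ˡ y∉)) ([≔]-fresh t B (∉-++⁻ʳ (vars A) y∉))
[≔]-fresh t (A ∨' B) y∉ =
  cong₂ _∨'_ ([≔]-fresh t A (∉-++⁻ˡ y∉)) ([≔]-fresh t B (∉-++⁻ʳ (vars A) y∉))
[≔]-fresh t (A ⇒ B) y∉ =
  cong₂ _⇒_ ([≔]-fresh t A (∉-++⁻ˡ y∉)) ([≔]-fresh t B (∉-++⁻ʳ (vars A) y∉))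
[≔]-fresh t (A ⇔ B) y∉ =
  cong₂ _⇔_ ([≔]-fresh t A (∉-++⁻ˡ y∉)) ([≔]-fresh t B (∉-++⁻ʳ (vars A) y∉))
[≔]-fresh {y} t (∀' z A) y∉ with y ≟ z
... | yes _ = refl
... | no _ = cong (∀' z) ([≔]-fresh t A (∉-∷⁻ y∉))
[≔]-fresh {y} t (∃' z A) y∉ with y ≟ z
... | yes _ = refl
... | no _ = cong (∃' z) ([≔]-fresh t A (∉-∷⁻ y∉))
[≔]-fresh {y} t (I z F G) y∉ with y ≟ z
... | yes _ = refl
... | no _ = cong₂ (I z) ([≔]-fresh t F (∉-++⁻ˡ (∉-∷⁻ y∉)))
                        ([≔]-fresh t G (∉-++⁻ʳ (vars F) (∉-∷⁻ y∉)))

I-[≔] : ∀ {x} F G t → x ≢ y → I x F G [ y ≔ t ] ≡ I x (F [ y ≔ t ]) (G [ y ≔ t ])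
I-[≔] {y} {x} F G t x≢y with y ≟ x
... | yes y≡x with () ← x≢y (sym y≡x)
... | no _ = refl

∉-paramsT-substT : ∀ x t u → k ∉ paramsT u → k ∉ paramsT ⌜ t ⌝ → k ∉ paramsT (substT x t u)
∉-paramsT-substT x t (var z) _ k∉t with x ≟ z
... | yes _ = k∉t
... | no _ = λ ()
∉-paramsT-substT x t (con c) k∉u _ = k∉u
∉-paramsT-substT x t (par a) k∉u _ = k∉u

∉-params-map-substT : ∀ x t us → k ∉ concatMap paramsT us → k ∉ paramsT ⌜ t ⌝ →
                      k ∉ concatMap paramsT (map (substT x t) us)
∉-params-map-substT x t [] _ _ = λ ()
∉-params-map-substT x t (u ∷ us) k∉ k∉t =
  ∉-++⁺ (∉-paramsT-substT x t u (∉-++⁻ˡ k∉) k∉t)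
        (∉-params-map-substT x t us (∉-++⁻ʳ (paramsT u) k∉) k∉t)

#-[≔] : ∀ x t A → k # A → k ∉ paramsT ⌜ t ⌝ → k # (A [ x ≔ t ])
#-[≔] x t (atom P us) k# k∉t = ∉-params-map-substT x t us k# k∉t
#-[≔] x t (E! u) k# k∉t = ∉-paramsT-substT x t u k# k∉t
#-[≔] x t (u ≐ v) k# k∉t =
  ∉-++⁺ (∉-paramsT-substT x t u (∉-++⁻ˡ k#) k∉t)
        (∉-paramsT-substT x t v (∉-++⁻ʳ (paramsT u) k#) k∉t)
#-[≔] x t ⊥' k# _ = k#
#-[≔] x t (A ∧' B) k# k∉t =
  ∉-++⁺ (#-[≔] x t A (∉-++⁻ˡ k#) k∉t) (#-[≔] x t B (∉-++⁻ʳ (params A) k#) k∉t)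
#-[≔] x t (A ∨' B) k# k∉t =
  ∉-++⁺ (#-[≔] x t A (∉-++⁻ˡ k#) k∉t) (#-[≔] x t B (∉-++⁻ʳ (params A) k#) k∉t)
#-[≔] x t (A ⇒ B) k# k∉t =
  ∉-++⁺ (#-[≔] x t A (∉-++⁻ˡ k#) k∉t) (#-[≔] x t B (∉-++⁻ʳ (params A) k#) k∉t)
#-[≔] x t (A ⇔ B) k# k∉t =
  ∉-++⁺ (#-[≔] x t A (∉-++⁻ˡ k#) k∉t) (#-[≔] x t B (∉-++⁻ʳ (params A) k#) k∉t)
#-[≔] x t (∀' z A) k# k∉t with x ≟ z
... | yes _ = k#
... | no _ = #-[≔] x t A k# k∉t
#-[≔] x t (∃' z A) k# k∉t with x ≟ z
... | yes _ = k#
... | no _ = #-[≔] x t A k# k∉t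
#-[≔] x t (I z F G) k# k∉t with x ≟ z
... | yes _ = k#
... | no _ =
  ∉-++⁺ (#-[≔] x t F (∉-++⁻ˡ k#) k∉t) (#-[≔] x t G (∉-++⁻ʳ (params F) k#) k∉t)

closed≐var-[≔] : ∀ x s t → (⌜ s ⌝ ≐ var x) [ x ≔ t ] ≡ ⌜ s ⌝ ≐ ⌜ t ⌝
closed≐var-[≔] x s t = cong₂ _≐_ (substT-closed x t s) (substT-self x t)

var≐closed-[≔] : ∀ x s t → (var x ≐ ⌜ s ⌝) [ x ≔ t ] ≡ ⌜ t ⌝ ≐ ⌜ s ⌝
var≐closed-[≔] x s t = cong₂ _≐_ (substT-self x t) (substT-closed x t s)

-- The variable 0 used for rewriting with =E is arbitrary: both sides are closed.
≐-sym : ∀ {s t} → Γ ⊢ ⌜ s ⌝ ≐ ⌜ t ⌝ → Γ ⊢ ⌜ t ⌝ ≐ ⌜ s ⌝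
≐-sym {Γ} {s} {t} s≐t =
  subst (Γ ⊢_) (var≐closed-[≔] 0 s t)
    (=E {x = 0} {A = var 0 ≐ ⌜ s ⌝} s t (eq _ _) s≐t
        (subst (Γ ⊢_) (sym (var≐closed-[≔] 0 s s)) (=I s)))

≐-trans : ∀ {s t u} → Γ ⊢ ⌜ s ⌝ ≐ ⌜ t ⌝ → Γ ⊢ ⌜ t ⌝ ≐ ⌜ u ⌝ → Γ ⊢ ⌜ s ⌝ ≐ ⌜ u ⌝
≐-trans {Γ} {s} {t} {u} s≐t t≐u =
  subst (Γ ⊢_) (closed≐var-[≔] 0 s u)
    (=E {x = 0} {A = ⌜ s ⌝ ≐ var 0} t u (eq _ _) t≐u
        (subst (Γ ⊢_) (sym (closed≐var-[≔] 0 s t)) s≐t))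

I≐-unique : ∀ {x F} s t → Γ ⊢ I x F (var x ≐ ⌜ t ⌝) → Γ ⊢ E! ⌜ s ⌝ → Γ ⊢ E! ⌜ t ⌝ →
            Γ ⊢ F [ x ≔ s ] → Γ ⊢ ⌜ s ⌝ ≐ ⌜ t ⌝
I≐-unique {Γ} {x} s t ιF s! t! Fs =
  subst (Γ ⊢_) (closed≐var-[≔] x s t)
    (IE⁴ᵖ {A = ⌜ s ⌝ ≐ var x} s t (eq _ _) ιF s! t! Fs
          (subst (Γ ⊢_) (sym (closed≐var-[≔] x s s)) (=I s)))

I≐⇒I∃! : ∀ {x F t} b c →
         b #ᶜ Γ → b # F → par b ≢ t → c #ᶜ Γ → c # F → c ≢ b →
         I x F (var x ≐ ⌜ t ⌝) ∈ Γ → E! ⌜ t ⌝ ∈ Γ → Γ ⊢ I x F (E! (var x))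
I≐⇒I∃! {Γ} {x} {F} {t} b c b#Γ b#F b≢t c#Γ c#F c≢b ιF∈ t!∈ =
  IE⁵ᵖ t b b#Γ b#F (∉-++⁺ b#F λ ()) b≢t (hyp ιF∈) (hyp t!∈)
    (II (par b) c c#Γ′ c#F (λ ()) (λ { refl → c≢b refl })
        (hyp (here refl)) b!ˣ (hyp (there (here refl))) c≐b)
  where
  Γ′ Γ″ : List Formula
  Γ′ = F [ x ≔ par b ] ∷ E! (par b) ∷ Γ
  Γ″ = F [ x ≔ par c ] ∷ E! (par c) ∷ Γ′

  c#Γ′ : c #ᶜ Γ′
  c#Γ′ = #-[≔] x (par b) F c#F ∉-[ c≢b ] ∷ ∉-[ c≢b ] ∷ c#Γ

  b!ˣ : Γ′ ⊢ E! (var x) [ x ≔ par b ]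
  b!ˣ = subst (Γ′ ⊢_) (cong E! (sym (substT-self x (par b)))) (hyp (there (here refl)))

  ∈Γ″ : ∀ {A} → A ∈ Γ → A ∈ Γ″
  ∈Γ″ = there ∘ there ∘ there ∘ there

  ≐t : ∀ k → Γ″ ⊢ E! (par k) → Γ″ ⊢ F [ x ≔ par k ] → Γ″ ⊢ par k ≐ ⌜ t ⌝
  ≐t k k! Fk = I≐-unique (par k) t (hyp (∈Γ″ ιF∈)) k! (hyp (∈Γ″ t!∈)) Fk

  c≐b : Γ″ ⊢ par c ≐ par b
  c≐b = ≐-trans (≐t c (hyp (there (here refl))) (hyp (here refl)))
                (≐-sym (≐t b (hyp (there (there (there (here refl)))))
                             (hyp (there (there (here refl))))))

mainTheorem13 : (F : Formula) (x y : ℕ) → x ≢ y → y ∉ vars F →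
                [ ∃' y (I x F (var x ≐ var y)) ] ⊢ I x F (E! (var x))
mainTheorem13 F x y x≢y y∉F =
  ∃E a (a#Γ₀ ∷ []) a#Γ₀ (∉-++⁺ (fresh 0) λ ()) (hyp (here refl))
    (subst (λ A → A ∷ E! (par a) ∷ Γ₀ ⊢ I x F (E! (var x))) (sym instance-a)
      (I≐⇒I∃! b c (fresh-ctx 1 1+n≢n) (fresh 1) (par-≢ 1+n≢n)
                  (fresh-ctx 2 (m+1+n≢n 1)) (fresh 2) 1+n≢n
                  (here refl) (there (here refl))))
  where
  Γ₀ : List Formula
  Γ₀ = [ ∃' y (I x F (var x ≐ var y)) ]

  a b c : ℕ
  a = suc (max 0 (params F))
  b = 1 + a
  c = 2 + a

  fresh : ∀ n → (n + a) # F
  fresh n = >max⇒∉ (m≤n+m a n)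

  a#Γ₀ : a # ∃' y (I x F (var x ≐ var y))
  a#Γ₀ = ∉-++⁺ (fresh 0) λ ()

  fresh-ctx : ∀ n → n + a ≢ a → (n + a) #ᶜ (I x F (var x ≐ par a) ∷ E! (par a) ∷ Γ₀)
  fresh-ctx n k≢a = ∉-++⁺ (fresh n) ∉-[ k≢a ] ∷ ∉-[ k≢a ] ∷ ∉-++⁺ (fresh n) (λ ()) ∷ []

  instance-a : I x F (var x ≐ var y) [ y ≔ par a ] ≡ I x F (var x ≐ par a)
  instance-a = trans (I-[≔] F _ (par a) x≢y)
    (cong₂ (I x) ([≔]-fresh (par a) F y∉F)
                 (cong₂ _≐_ (substT-fresh (par a) (var x) ∉-[ x≢y ∘ sym ]) (substT-self y (par a))))
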